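{- Let $\mathbf V$ be a unital quantale, let $(\mathbf A,F)$ be a $\mathbf V$-F-semilattice and let $X\subseteq A\times A$ satisfy $(F\times F)(X)\cup\{(v*c,v*d)\mid (c,d)\in X,\ v\in V\}\subseteq X$. Then $j[X]$ is a $\mathbf V$-F-prenucleus on $(\mathbf A,F)$. Moreover, for every $\mathbf V$-F-semilattice $(\mathbf B,F_{\mathbf B})$ and every lax morphism $g\colon(\mathbf A,F)\to(\mathbf B,F_{\mathbf B})$ such that $g(c)=g(d)$ for all $(c,d)\in X$, there is a unique lax morphism $\overline g\colon(\mathbf A_{\mathrm n(j[X])},F_{\mathbf A_{\mathrm n(j[X])}})\to(\mathbf B,F_{\mathbf B})$ with $g=\overline g\circ\mathrm n(j[X])$.
   Context: A unital quantale $\mathbf V=(V,\bigvee,\otimes,e)$: complete lattice, monoid, $\otimes$ distributing over arbitrary joins on both sides. A $\mathbf V$-module $(A,\bigvee,*)$: complete lattice with $*\colon V\times A\to A$ preserving joins in each argument, $u*(v*a)=(u\otimes v)*a$, $e*a=a$; module homomorphisms preserve arbitrary joins and the action. A $\mathbf V$-F-semilattice is $(\mathbf A,F)$ with $F$ a module endomorphism; a lax morphism $g\colon(\mathbf A,F)\to(\mathbf B,F_{\mathbf B})$ is a module homomorphism with $F_{\mathbf B}(g(a))\le g(F(a))$. A $\mathbf V$-F-prenucleus is $j\colon A\to A$ with $a\le j(a)$, monotone, $v*j(a)\le j(v*a)$, $F(j(a))\le j(F(a))$; a nucleus is additionally idempotent. For a prenucleus $j$: $A_j=\{a\mid j(a)=a\}$,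 $\mathrm n(j)(a)=\bigwedge\{x\in A_j\mid a\le x\}$ (a nucleus). For a nucleus $k$, $\mathbf A_k$ is the module on $A_k$ with joins $k(\bigvee S)$ and action $v*_{\mathbf A_k}a=k(v*a)$, and $F_{\mathbf A_k}=k\circ F$ on $A_k$; $\mathrm n(j[X])$ is regarded as a map $A\to A_{\mathrm n(j[X])}$. For $X\subseteq A\times A$, $j[X](a)=a\vee\bigvee\{c\in A\mid \exists d\in A:\ d\le a,\ (c,d)\in X\text{ or }(d,c)\in X\}$. -}

module Defs where

open import Level using (Level; suc)
open import Data.Product using (Σ; _×_; _,_; proj₁; proj₂)
open import Data.Sum using (_⊎_; inj₁; inj₂)
open import Relation.Binary.PropositionalEquality using (_≡_; refl)
open import Relation.Binary.Structures using (IsPartialOrder)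
open import Relation.Unary using (Pred)

Image : ∀ {ℓ} {A B : Set ℓ} → (A → B) → Pred A ℓ → Pred B ℓ
Image {A = A} f S y = Σ A λ x → S x × y ≡ f x

record CompleteLattice ℓ : Set (suc ℓ) where
  field
    Carrier        : Set ℓ
    _≤_            : Carrier → Carrier → Set ℓ
  infix 4 _≤_
  field
    isPartialOrder : IsPartialOrder _≡_ _≤_
    ⋁              : Pred Carrier ℓ → Carrier
    ⋁-upper        : ∀ S x → S x → x ≤ ⋁ S
    ⋁-least        : ∀ S y → (∀ x → S x → x ≤ y) → ⋁ S ≤ y

  open IsPartialOrder isPartialOrder public

  infixr 6 _∨_
  _∨_ : Carrier → Carrier → Carrier
  a ∨ b = ⋁ (λ x → x ≡ a ⊎ x ≡ b)

  ⋀ : Pred Carrier ℓ → Carrier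
  ⋀ S = ⋁ (λ y → ∀ x → S x → y ≤ x)

record UnitalQuantale ℓ : Set (suc ℓ) where
  field
    lattice : CompleteLattice ℓ
  open CompleteLattice lattice public
  field
    _⊗_          : Carrier → Carrier → Carrier
  infixr 7 _⊗_
  field
    e            : Carrier
    ⊗-assoc      : ∀ u v w → (u ⊗ v) ⊗ w ≡ u ⊗ (v ⊗ w)
    ⊗-identityˡ  : ∀ u → e ⊗ u ≡ u
    ⊗-identityʳ  : ∀ u → u ⊗ e ≡ u
    ⊗-distribˡ-⋁ : ∀ u S → u ⊗ ⋁ S ≡ ⋁ (Image (u ⊗_) S)
    ⊗-distribʳ-⋁ : ∀ S u → ⋁ S ⊗ u ≡ ⋁ (Image (_⊗ u) S)

record Module {ℓ} (V : UnitalQuantale ℓ) : Set (suc ℓ) where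
  private module V = UnitalQuantale V
  field
    lattice : CompleteLattice ℓ
  open CompleteLattice lattice public
  field
    _*_          : V.Carrier → Carrier → Carrier
  infixr 7 _*_
  field
    *-distribˡ-⋁ : ∀ v S → v * ⋁ S ≡ ⋁ (Image (v *_) S)
    *-distribʳ-⋁ : ∀ S a → V.⋁ S * a ≡ ⋁ (Image (_* a) S)
    *-assoc      : ∀ u v a → u * (v * a) ≡ (u V.⊗ v) * a
    *-identity   : ∀ a → V.e * a ≡ a

-- Raw data of a V-F-semilattice (carrier, order, joins, action, F),
-- used to state the (lax) morphism conditions uniformly.

record RawFSL {ℓ} (V : UnitalQuantale ℓ) : Set (suc ℓ) where
  private module V = UnitalQuantale V
  field
    Carrier : Set ℓ
    _≤_     : Carrier → Carrier → Set ℓ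
    ⋁       : Pred Carrier ℓ → Carrier
    _*_     : V.Carrier → Carrier → Carrier
  infix 4 _≤_
  infixr 7 _*_
  field
    F       : Carrier → Carrier

module _ {ℓ} {V : UnitalQuantale ℓ} where

  IsModuleHom : (A B : RawFSL V) → (RawFSL.Carrier A → RawFSL.Carrier B) → Set (suc ℓ)
  IsModuleHom A B g =
    (∀ S → g (A.⋁ S) ≡ B.⋁ (Image g S)) × (∀ v a → g (v A.* a) ≡ v B.* g a)
    where module A = RawFSL A
          module B = RawFSL B

  IsLaxMorphism : (A B : RawFSL V) → (RawFSL.Carrier A → RawFSL.Carrier B) → Set (suc ℓ)
  IsLaxMorphism A B g = IsModuleHom A B g × (∀ a → B.F (g a) B.≤ g (A.F a))
    where module A = RawFSL A
          module B = RawFSL B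

record FSemilattice {ℓ} (V : UnitalQuantale ℓ) : Set (suc ℓ) where
  field
    module′ : Module V
  open Module module′ public
  field
    F   : Carrier → Carrier
    F-⋁ : ∀ S → F (⋁ S) ≡ ⋁ (Image F S)
    F-* : ∀ v a → F (v * a) ≡ v * F a

  raw : RawFSL V
  raw = record { Carrier = Carrier ; _≤_ = _≤_ ; ⋁ = ⋁ ; _*_ = _*_ ; F = F }

module _ {ℓ} {V : UnitalQuantale ℓ} (A : FSemilattice V) where
  open FSemilattice A

  record IsPrenucleus (j : Carrier → Carrier) : Set ℓ where
    field
      extensive : ∀ a → a ≤ j a
      monotone  : ∀ a b → a ≤ b → j a ≤ j b
      *-lax     : ∀ v a → v * j a ≤ j (v * a)
      F-lax     : ∀ a → F (j a) ≤ j (F a)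

  Fix : (Carrier → Carrier) → Set ℓ
  Fix k = Σ Carrier λ a → k a ≡ a

  n : (Carrier → Carrier) → Carrier → Carrier
  n j a = ⋀ (λ x → j x ≡ x × a ≤ x)

  n-idem : ∀ j a → n j (n j a) ≡ n j a
  n-idem j a = antisym le₁ le₂
    where
      U : Pred Carrier ℓ
      U x = j x ≡ x × a ≤ x
      L : Pred Carrier ℓ
      L y = ∀ x → U x → y ≤ x
      b : Carrier
      b = ⋁ L
      b≤U : ∀ x → U x → b ≤ x
      b≤U x Ux = ⋁-least L x (λ z zL → zL x Ux)
      le₁ : n j b ≤ b
      le₁ = ⋁-least _ b (λ y yL′ → ⋁-upper L y (λ x Ux → yL′ x (proj₁ Ux , b≤U x Ux)))
      le₂ : b ≤ n j b
      le₂ = ⋁-upper _ b (λ x Ux′ → proj₂ Ux′)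

  ι : (j : Carrier → Carrier) → Carrier → Fix (n j)
  ι j a = n j a , n-idem j a

  Quot : (Carrier → Carrier) → RawFSL V
  Quot j = record
    { Carrier = Fix (n j)
    ; _≤_     = λ x y → proj₁ x ≤ proj₁ y
    ; ⋁       = λ S → ι j (⋁ (λ a → Σ (n j a ≡ a) λ p → S (a , p)))
    ; _*_     = λ v x → ι j (v * proj₁ x)
    ; F       = λ x → ι j (F (proj₁ x))
    }

  j[_] : (Carrier → Carrier → Set ℓ) → Carrier → Carrier
  j[ X ] a = a ∨ ⋁ (λ c → Σ Carrier λ d → d ≤ a × (X c d ⊎ X d c))

  StableRel : (Carrier → Carrier → Set ℓ) → Set ℓ
  StableRel X = (∀ c d → X c d → X (F c) (F d))
              × (∀ v c d → X c d → X (v * c) (v * d))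

-- j[X] adds to a everything X-related to some element below a, so it commutes laxly with
-- every join-preserving endomap under which X is stable, in particular v * _ and F.
-- If a join-preserving g identifies X-related elements then g ∘ j[X] ≤ g, so the largest
-- element b with g b ≤ g a is a fixed point of j[X] above a; hence n(j[X]) a ≤ b and
-- g ∘ n(j[X]) = g.  The restriction of g to the fixed points is therefore the required
-- factorisation, and it is unique because every fixed point is the quotient join of its
-- own singleton, which a lax morphism must send to the image under g.
module Submission where

open import Defs
open import Data.Product using (Σ; _×_; _,_; proj₁; proj₂)
open import Data.Sum using (_⊎_; inj₁; inj₂)
open import Relation.Binary.PropositionalEquality
  using (_≡_; refl; sym; trans; cong; subst; module ≡-Reasoning)
open import Relation.Unary using (Pred)

module CompleteLatticeProperties {ℓ} (L : CompleteLattice ℓ) where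
  open CompleteLattice L renaming (refl to ≤-refl)

  x≤x∨y : ∀ x y → x ≤ x ∨ y
  x≤x∨y x y = ⋁-upper _ x (inj₁ refl)

  y≤x∨y : ∀ x y → y ≤ x ∨ y
  y≤x∨y x y = ⋁-upper _ y (inj₂ refl)

  ∨-least : ∀ {x y z} → x ≤ z → y ≤ z → x ∨ y ≤ z
  ∨-least x≤z y≤z = ⋁-least _ _ λ { _ (inj₁ refl) → x≤z ; _ (inj₂ refl) → y≤z }

  x≤y⇒x∨y≡y : ∀ {x y} → x ≤ y → x ∨ y ≡ y
  x≤y⇒x∨y≡y {x} {y} x≤y = antisym (∨-least x≤y ≤-refl) (y≤x∨y x y)

  ⋁-mono : ∀ {S T : Pred Carrier ℓ} → (∀ x → S x → T x) → ⋁ S ≤ ⋁ T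
  ⋁-mono {S} {T} S⊆T = ⋁-least S (⋁ T) λ x Sx → ⋁-upper T x (S⊆T x Sx)

  ⋁-cong : ∀ {S T : Pred Carrier ℓ} → (∀ x → S x → T x) → (∀ x → T x → S x) → ⋁ S ≡ ⋁ T
  ⋁-cong S⊆T T⊆S = antisym (⋁-mono S⊆T) (⋁-mono T⊆S)

  ⋁-Image-singleton : ∀ {I : Set ℓ} (f : I → Carrier) i → ⋁ (Image f (_≡ i)) ≡ f i
  ⋁-Image-singleton f i =
    antisym (⋁-least _ _ λ { _ (_ , refl , refl) → ≤-refl }) (⋁-upper _ _ (i , refl , refl))

module JoinPreserving {ℓ} (L₁ L₂ : CompleteLattice ℓ)
  (f : CompleteLattice.Carrier L₁ → CompleteLattice.Carrier L₂)
  (f-⋁ : ∀ S → f (CompleteLattice.⋁ L₁ S) ≡ CompleteLattice.⋁ L₂ (Image f S)) where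
  private
    module L₁ = CompleteLattice L₁
    module L₂ = CompleteLattice L₂
    module P₁ = CompleteLatticeProperties L₁

  f-⋁-least : ∀ {S z} → (∀ x → S x → f x L₂.≤ z) → f (L₁.⋁ S) L₂.≤ z
  f-⋁-least {S} {z} bound = subst (L₂._≤ z) (sym (f-⋁ S))
    (L₂.⋁-least _ z λ { _ (x , Sx , refl) → bound x Sx })

  f-∨-least : ∀ {x y z} → f x L₂.≤ z → f y L₂.≤ z → f (x L₁.∨ y) L₂.≤ z
  f-∨-least fx≤z fy≤z = f-⋁-least λ { _ (inj₁ refl) → fx≤z ; _ (inj₂ refl) → fy≤z }

  monotone : ∀ {x y} → x L₁.≤ y → f x L₂.≤ f y
  monotone {x} {y} x≤y = subst (λ t → f x L₂.≤ f t) (P₁.x≤y⇒x∨y≡y x≤y)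
    (subst (f x L₂.≤_) (sym (f-⋁ _)) (L₂.⋁-upper _ (f x) (x , inj₁ refl , refl)))

module GeneratedPrenucleus {ℓ} {V : UnitalQuantale ℓ} (A : FSemilattice V)
  (X : FSemilattice.Carrier A → FSemilattice.Carrier A → Set ℓ) where
  open FSemilattice A renaming (trans to ≤-trans)
  open CompleteLatticeProperties lattice

  Linked : Carrier → Pred Carrier ℓ
  Linked a c = Σ Carrier λ d → d ≤ a × (X c d ⊎ X d c)

  j : Carrier → Carrier
  j = j[_] A X

  j-extensive : ∀ a → a ≤ j a
  j-extensive a = x≤x∨y a _

  Linked⇒≤j : ∀ {a c} → Linked a c → c ≤ j a
  Linked⇒≤j {a} {c} linked = ≤-trans (⋁-upper (Linked a) c linked) (y≤x∨y a _)

  j-monotone : ∀ a b → a ≤ b → j a ≤ j b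
  j-monotone a b a≤b = ∨-least (≤-trans a≤b (j-extensive b))
    (≤-trans (⋁-mono λ { _ (d , d≤a , x) → d , ≤-trans d≤a a≤b , x }) (y≤x∨y b _))

  j-lax : (f : Carrier → Carrier) → (∀ S → f (⋁ S) ≡ ⋁ (Image f S))
        → (∀ c d → X c d → X (f c) (f d)) → ∀ a → f (j a) ≤ j (f a)
  j-lax f f-⋁ X-stable a = f-∨-least (j-extensive (f a)) (f-⋁-least image-linked)
    where
    open JoinPreserving lattice lattice f f-⋁

    image-linked : ∀ c → Linked a c → f c ≤ j (f a)
    image-linked c (d , d≤a , inj₁ x) = Linked⇒≤j (f d , monotone d≤a , inj₁ (X-stable c d x))
    image-linked c (d , d≤a , inj₂ x) = Linked⇒≤j (f d , monotone d≤a , inj₂ (X-stable d c x))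

  respects-X⇒g∘j≤g : ∀ (B : CompleteLattice ℓ) (g : Carrier → CompleteLattice.Carrier B)
    → (∀ S → g (⋁ S) ≡ CompleteLattice.⋁ B (Image g S))
    → (∀ c d → X c d → g c ≡ g d)
    → ∀ a → CompleteLattice._≤_ B (g (j a)) (g a)
  respects-X⇒g∘j≤g B g g-⋁ g-respects-X a = f-∨-least B.refl (f-⋁-least λ
    { c (d , d≤a , inj₁ x) → subst (B._≤ g a) (sym (g-respects-X c d x)) (monotone d≤a)
    ; c (d , d≤a , inj₂ x) → subst (B._≤ g a) (g-respects-X d c x) (monotone d≤a) })
    where
    module B = CompleteLattice B
    open JoinPreserving lattice B g g-⋁

  j-isPrenucleus : StableRel A X → IsPrenucleus A j
  j-isPrenucleus (F-stable , *-stable) = record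
    { extensive = j-extensive
    ; monotone  = j-monotone
    ; *-lax     = λ v → j-lax (v *_) (*-distribˡ-⋁ v) (*-stable v)
    ; F-lax     = j-lax F F-⋁ F-stable
    }

module NucleusClosure {ℓ} {V : UnitalQuantale ℓ} (A : FSemilattice V) where
  open FSemilattice A

  n-extensive : ∀ j a → a ≤ n A j a
  n-extensive j a = ⋁-upper _ a λ _ → proj₂

  n-least : ∀ j {a b} → j b ≡ b → a ≤ b → n A j a ≤ b
  n-least j jb≡b a≤b = ⋁-least _ _ λ _ lower → lower _ (jb≡b , a≤b)

  hom-∘-n : ∀ (B : CompleteLattice ℓ) (g : Carrier → CompleteLattice.Carrier B)
    (g-⋁ : ∀ S → g (⋁ S) ≡ CompleteLattice.⋁ B (Image g S))
    (j : Carrier → Carrier) → (∀ a → a ≤ j a)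
    → (∀ a → CompleteLattice._≤_ B (g (j a)) (g a))
    → ∀ a → g (n A j a) ≡ g a
  hom-∘-n B g g-⋁ j j-extensive g∘j≤g a =
    B.antisym (B.trans (monotone (n-least j jb≡b a≤b)) gb≤ga) (monotone (n-extensive j a))
    where
    module B = CompleteLattice B
    open JoinPreserving lattice B g g-⋁

    b : Carrier
    b = ⋁ λ y → g y B.≤ g a

    gb≤ga : g b B.≤ g a
    gb≤ga = f-⋁-least λ _ gy≤ga → gy≤ga

    a≤b : a ≤ b
    a≤b = ⋁-upper _ a B.refl

    jb≡b : j b ≡ b
    jb≡b = antisym (⋁-upper _ (j b) (B.trans (g∘j≤g b) gb≤ga)) (j-extensive b)

module Factorisation {ℓ} {V : UnitalQuantale ℓ} (A : FSemilattice V)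
  (j : FSemilattice.Carrier A → FSemilattice.Carrier A) where
  private
    module A = FSemilattice A
    module Q = RawFSL (Quot A j)

  Quot-⋁-singleton : ∀ x → Q.⋁ (_≡ x) ≡ ι A j (proj₁ x)
  Quot-⋁-singleton x = cong (ι A j) (A.antisym
    (A.⋁-least _ _ λ { _ (_ , refl) → A.refl })
    (A.⋁-upper _ _ (proj₂ x , refl)))

  -- Routed through joins: x and ι (proj₁ x) have the same carrier element, but without K
  -- their fixed-point proofs need not be equal.
  hom-ι-proj₁ : ∀ (B : FSemilattice V) (h : Fix A (n A j) → FSemilattice.Carrier B)
    → IsModuleHom (Quot A j) (FSemilattice.raw B) h
    → ∀ x → h x ≡ h (ι A j (proj₁ x))
  hom-ι-proj₁ B h (h-⋁ , _) x = begin
    h x                       ≡⟨ sym (⋁-Image-singleton h x) ⟩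
    B.⋁ (Image h (_≡ x))      ≡⟨ sym (h-⋁ (_≡ x)) ⟩
    h (Q.⋁ (_≡ x))            ≡⟨ cong h (Quot-⋁-singleton x) ⟩
    h (ι A j (proj₁ x))       ∎
    where
    module B = FSemilattice B
    open CompleteLatticeProperties B.lattice
    open ≡-Reasoning

  module _ (B : FSemilattice V) (g : A.Carrier → FSemilattice.Carrier B)
    (g-lax : IsLaxMorphism A.raw (FSemilattice.raw B) g)
    (g∘n≡g : ∀ a → g (n A j a) ≡ g a) where
    private
      module B = FSemilattice B
      open CompleteLatticeProperties B.lattice

    restrict : Fix A (n A j) → B.Carrier
    restrict x = g (proj₁ x)

    restrict-isLaxMorphism : IsLaxMorphism (Quot A j) B.raw restrict
    restrict-isLaxMorphism = (restrict-⋁ , restrict-*) , restrict-F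
      where
      g-⋁ : ∀ S → g (A.⋁ S) ≡ B.⋁ (Image g S)
      g-⋁ = proj₁ (proj₁ g-lax)

      g-* : ∀ v a → g (v A.* a) ≡ v B.* g a
      g-* = proj₂ (proj₁ g-lax)

      g-F : ∀ a → B.F (g a) B.≤ g (A.F a)
      g-F = proj₂ g-lax

      restrict-⋁ : ∀ S → restrict (Q.⋁ S) ≡ B.⋁ (Image restrict S)
      restrict-⋁ S = trans (g∘n≡g _) (trans (g-⋁ _) (⋁-cong
        (λ { _ (a , (p , s) , refl) → (a , p) , s , refl })
        (λ { _ ((a , p) , s , refl) → a , (p , s) , refl })))

      restrict-* : ∀ v x → restrict (v Q.* x) ≡ v B.* restrict x
      restrict-* v x = trans (g∘n≡g _) (g-* v (proj₁ x))

      restrict-F : ∀ x → B.F (restrict x) B.≤ restrict (Q.F x)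
      restrict-F x = subst (B.F (restrict x) B.≤_) (sym (g∘n≡g _)) (g-F (proj₁ x))

    restrict-unique : (h : Fix A (n A j) → B.Carrier)
      → IsLaxMorphism (Quot A j) B.raw h
      → (∀ a → g a ≡ h (ι A j a)) → ∀ x → h x ≡ restrict x
    restrict-unique h (h-hom , _) g≡h∘ι x =
      trans (hom-ι-proj₁ B h h-hom x) (sym (g≡h∘ι (proj₁ x)))

mainTheorem13 : ∀ {ℓ} (V : UnitalQuantale ℓ) (A : FSemilattice V)
    (X : FSemilattice.Carrier A → FSemilattice.Carrier A → Set ℓ)
    → StableRel A X
    → IsPrenucleus A (j[_] A X)
    × ((B : FSemilattice V)
    (g : FSemilattice.Carrier A → FSemilattice.Carrier B)
    → IsLaxMorphism (FSemilattice.raw A) (FSemilattice.raw B) g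
    → (∀ c d → X c d → g c ≡ g d)
    → Σ (Fix A (n A (j[_] A X)) → FSemilattice.Carrier B) λ ḡ
    → IsLaxMorphism (Quot A (j[_] A X)) (FSemilattice.raw B) ḡ
    × (∀ a → g a ≡ ḡ (ι A (j[_] A X) a))
    × ((h : Fix A (n A (j[_] A X)) → FSemilattice.Carrier B)
    → IsLaxMorphism (Quot A (j[_] A X)) (FSemilattice.raw B) h
    → (∀ a → g a ≡ h (ι A (j[_] A X) a))
    → ∀ x → h x ≡ ḡ x))
mainTheorem13 V A X X-stable = j-isPrenucleus X-stable , λ B g g-lax g-respects-X →
  let open FSemilattice B using (lattice)
      g-⋁ : ∀ S → g (FSemilattice.⋁ A S) ≡ FSemilattice.⋁ B (Image g S)
      g-⋁ = proj₁ (proj₁ g-lax)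
      g∘n≡g : ∀ a → g (n A j a) ≡ g a
      g∘n≡g = hom-∘-n lattice g g-⋁ j j-extensive (respects-X⇒g∘j≤g lattice g g-⋁ g-respects-X)
  in restrict B g g-lax g∘n≡g ,
     restrict-isLaxMorphism B g g-lax g∘n≡g ,
     (λ a → sym (g∘n≡g a)) ,
     restrict-unique B g g-lax g∘n≡g
  where
  open GeneratedPrenucleus A X
  open NucleusClosure A
  open Factorisation A j
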